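{- Let $n,d$ be integers with $n>d\ge 0$. Then $$\sum_{k=0}^{n-1}\binom{k}{d}_2=\sum_{\substack{1\le k\le n\\ k+d\equiv 1\pmod 2}}\binom{n}{k}\binom{k-1}{\frac{k+d-1}{2}}.$$
   Context: The trinomial coefficients $\binom{n}{k}_2$ are defined for integers $n\ge 0$ by $(1+x+x^{ -1})^n=\sum_{k=-n}^{n}\binom{n}{k}_2x^k$. -}

module Defs where

open import Data.Nat using (ℕ; zero; suc; _+_)
open import Data.Integer using (ℤ; +_) renaming (_+_ to _+ℤ_; _-_ to _-ℤ_)
open import Data.Integer.Properties using ()
open import Relation.Nullary using (yes; no)
open import Data.Integer using (_≟_)
open import Data.List using (List; map; upTo)
open import Data.Nat.ListAction using (sum)

-- Trinomial coefficient  binom(n,k)_2 = coefficient of x^k in (1 + x + x⁻¹)^n,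
-- computed by coefficient extraction of the product (1+x+x⁻¹)^(n+1) = (1+x+x⁻¹)^n·(1+x+x⁻¹):
--   [x^k](1+x+x⁻¹)^0 = [k = 0]
--   [x^k](1+x+x⁻¹)^(n+1) = [x^(k-1)]P + [x^k]P + [x^(k+1)]P  where P = (1+x+x⁻¹)^n.
trinom : ℕ → ℤ → ℕ
trinom zero k with k ≟ + 0
... | yes _ = 1
... | no _ = 0
trinom (suc n) k = trinom n (k -ℤ + 1) + trinom n k + trinom n (k +ℤ + 1)

sumFrom : ℕ → ℕ → (ℕ → ℕ) → ℕ
sumFrom a m f = sum (map (λ j → f (a + j)) (upTo m))

{-# OPTIONS --safe #-}
module Submission where

-- Writing 1 + x + x⁻¹ = 1 + (x + x⁻¹), the binomial theorem gives
-- binom(k,d)_2 = ∑_j C(k,j)·[x^d](x + x⁻¹)^j.  Summing over k < n and using the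
-- hockey-stick identity ∑_{k<n} C(k,j) = C(n,j+1) yields ∑_j C(n,j+1)·[x^d](x + x⁻¹)^j,
-- and [x^d](x + x⁻¹)^j is C(j,(j+d)/2) when j + d is even and 0 otherwise.

open import Defs
open import Data.Nat using (ℕ; suc; _+_; _*_; _∸_; _<_; _/_; _%_; _≡ᵇ_)
open import Data.Nat.Combinatorics using (_C_)
open import Data.Integer using (+_)
open import Data.Bool using (if_then_else_)
open import Relation.Binary.PropositionalEquality using (_≡_)

open import Data.Nat using (zero)
open import Data.Nat.Properties
  using (+-assoc; +-comm; +-suc; +-identityʳ; suc-injective; n<1+n; m≤m+n; m+n∸m≡n;
         *-distribˡ-+; *-distribʳ-+; *-zeroʳ; +-commutativeSemigroup)
open import Algebra.Properties.CommutativeSemigroup +-commutativeSemigroup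
  using (xy∙z≈y∙xz; x∙yz≈xz∙y)
open import Data.Nat.Combinatorics using (nCk+nC[k+1]≡[n+1]C[k+1]; k>n⇒nCk≡0; nCk≡nC[n∸k])
open import Data.Nat.DivMod using ([m+kn]%n≡m%n; m*n%n≡0; m*n/n≡m)
open import Data.Nat.Tactic.RingSolver using (solve-∀)
open import Data.Integer using (ℤ; -[1+_]; -_) renaming (_+_ to _+ℤ_; _-_ to _-ℤ_)
open import Data.Integer.Properties using (neg-distrib-+)
open import Data.List using (map; applyUpTo)
open import Data.Nat.ListAction using (sum)
open import Data.Product using (∃-syntax; _,_)
open import Data.Sum using (_⊎_; inj₁; inj₂)
open import Function using (_∘_)
open import Relation.Binary.PropositionalEquality using (refl; sym; trans; cong; cong₂; module ≡-Reasoning)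
open ≡-Reasoning

∑ : ℕ → (ℕ → ℕ) → ℕ
∑ zero    f = 0
∑ (suc m) f = f 0 + ∑ m (f ∘ suc)

sum-map-applyUpTo : ∀ m (f h : ℕ → ℕ) → sum (map f (applyUpTo h m)) ≡ ∑ m (f ∘ h)
sum-map-applyUpTo zero    f h = refl
sum-map-applyUpTo (suc m) f h = cong (_+_ (f (h 0))) (sum-map-applyUpTo m f (h ∘ suc))

sumFrom≡∑ : ∀ a m f → sumFrom a m f ≡ ∑ m (λ j → f (a + j))
sumFrom≡∑ a m f = sum-map-applyUpTo m (λ j → f (a + j)) (λ j → j)

∑-cong : ∀ m {f g : ℕ → ℕ} → (∀ j → f j ≡ g j) → ∑ m f ≡ ∑ m g
∑-cong zero    f≡g = refl
∑-cong (suc m) f≡g = cong₂ _+_ (f≡g 0) (∑-cong m (f≡g ∘ suc))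

∑-distrib-+ : ∀ m (f g : ℕ → ℕ) → ∑ m (λ j → f j + g j) ≡ ∑ m f + ∑ m g
∑-distrib-+ zero    f g = refl
∑-distrib-+ (suc m) f g = begin
  f 0 + g 0 + ∑ m (λ j → f (suc j) + g (suc j)) ≡⟨ cong (_+_ (f 0 + g 0)) (∑-distrib-+ m (f ∘ suc) (g ∘ suc)) ⟩
  f 0 + g 0 + (∑ m (f ∘ suc) + ∑ m (g ∘ suc))   ≡⟨ interchange (f 0) (g 0) _ _ ⟩
  f 0 + ∑ m (f ∘ suc) + (g 0 + ∑ m (g ∘ suc))   ∎
  where
  interchange : ∀ a b c d → a + b + (c + d) ≡ a + c + (b + d)
  interchange = solve-∀

∑-suc : ∀ m (f : ℕ → ℕ) → ∑ (suc m) f ≡ ∑ m f + f m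
∑-suc zero    f = +-comm (f 0) 0
∑-suc (suc m) f = begin
  f 0 + ∑ (suc m) (f ∘ suc)          ≡⟨ cong (_+_ (f 0)) (∑-suc m (f ∘ suc)) ⟩
  f 0 + (∑ m (f ∘ suc) + f (suc m))  ≡⟨ sym (+-assoc (f 0) _ _) ⟩
  f 0 + ∑ m (f ∘ suc) + f (suc m)    ∎

∑-C-suc-drop-last : ∀ m (g : ℕ → ℕ) → ∑ (suc m) (λ j → (m C suc j) * g j) ≡ ∑ m (λ j → (m C suc j) * g j)
∑-C-suc-drop-last m g = begin
  ∑ (suc m) (λ j → (m C suc j) * g j)               ≡⟨ ∑-suc m _ ⟩
  ∑ m (λ j → (m C suc j) * g j) + (m C suc m) * g m ≡⟨ cong (λ c → ∑ m (λ j → (m C suc j) * g j) + c * g m) (k>n⇒nCk≡0 (n<1+n m)) ⟩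
  ∑ m (λ j → (m C suc j) * g j) + 0                 ≡⟨ +-identityʳ _ ⟩
  ∑ m (λ j → (m C suc j) * g j)                     ∎

∑-pascal : ∀ m n (g : ℕ → ℕ) →
  ∑ m (λ j → (suc n C suc j) * g j) ≡ ∑ m (λ j → (n C j) * g j) + ∑ m (λ j → (n C suc j) * g j)
∑-pascal m n g = begin
  ∑ m (λ j → (suc n C suc j) * g j)                         ≡⟨ ∑-cong m pascal-term ⟩
  ∑ m (λ j → (n C j) * g j + (n C suc j) * g j)             ≡⟨ ∑-distrib-+ m _ _ ⟩
  ∑ m (λ j → (n C j) * g j) + ∑ m (λ j → (n C suc j) * g j) ∎
  where
  pascal-term : ∀ j → (suc n C suc j) * g j ≡ (n C j) * g j + (n C suc j) * g j
  pascal-term j = trans (cong (_* g j) (sym (nCk+nC[k+1]≡[n+1]C[k+1] n j))) (*-distribʳ-+ (g j) (n C j) (n C suc j))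

-- (1 + y)^(m+1) = (1 + y)^m + (1 + y)^m·y, paired with the coefficient sequence g of a series in y.
binomial-step : ∀ m (g : ℕ → ℕ) →
  ∑ (suc (suc m)) (λ j → (suc m C j) * g j) ≡ ∑ (suc m) (λ j → (m C j) * g j) + ∑ (suc m) (λ j → (m C j) * g (suc j))
binomial-step m g = begin
  1 * g 0 + ∑ (suc m) (λ j → (suc m C suc j) * g (suc j))
    ≡⟨ cong (_+_ (1 * g 0)) (∑-pascal (suc m) m (g ∘ suc)) ⟩
  1 * g 0 + (∑ (suc m) (λ j → (m C j) * g (suc j)) + ∑ (suc m) (λ j → (m C suc j) * g (suc j)))
    ≡⟨ cong (λ s → 1 * g 0 + (∑ (suc m) (λ j → (m C j) * g (suc j)) + s)) (∑-C-suc-drop-last m (g ∘ suc)) ⟩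
  1 * g 0 + (∑ (suc m) (λ j → (m C j) * g (suc j)) + ∑ m (λ j → (m C suc j) * g (suc j)))
    ≡⟨ x∙yz≈xz∙y (1 * g 0) _ _ ⟩
  1 * g 0 + ∑ m (λ j → (m C suc j) * g (suc j)) + ∑ (suc m) (λ j → (m C j) * g (suc j))
    ∎

hockey-stick : ∀ n (g : ℕ → ℕ) → ∑ n (λ k → ∑ (suc k) (λ j → (k C j) * g j)) ≡ ∑ n (λ j → (n C suc j) * g j)
hockey-stick zero    g = refl
hockey-stick (suc n) g = begin
  ∑ (suc n) (λ k → ∑ (suc k) (λ j → (k C j) * g j))
    ≡⟨ ∑-suc n _ ⟩
  ∑ n (λ k → ∑ (suc k) (λ j → (k C j) * g j)) + ∑ (suc n) (λ j → (n C j) * g j)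
    ≡⟨ cong (_+ ∑ (suc n) (λ j → (n C j) * g j)) (hockey-stick n g) ⟩
  ∑ n (λ j → (n C suc j) * g j) + ∑ (suc n) (λ j → (n C j) * g j)
    ≡⟨ cong (_+ ∑ (suc n) (λ j → (n C j) * g j)) (sym (∑-C-suc-drop-last n g)) ⟩
  ∑ (suc n) (λ j → (n C suc j) * g j) + ∑ (suc n) (λ j → (n C j) * g j)
    ≡⟨ +-comm (∑ (suc n) (λ j → (n C suc j) * g j)) _ ⟩
  ∑ (suc n) (λ j → (n C j) * g j) + ∑ (suc n) (λ j → (n C suc j) * g j)
    ≡⟨ sym (∑-pascal (suc n) n g) ⟩
  ∑ (suc n) (λ j → (suc n C suc j) * g j)
    ∎

-- walks j z = [x^z](x + x⁻¹)^j, the number of ±1 walks of length j from 0 to z.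
walks : ℕ → ℤ → ℕ
walks zero    (+ zero)  = 1
walks zero    (+ suc _) = 0
walks zero    -[1+ _ ]  = 0
walks (suc j) z         = walks j (z -ℤ + 1) + walks j (z +ℤ + 1)

walks-neg : ∀ j z → walks j (- z) ≡ walks j z
walks-neg zero    (+ zero)  = refl
walks-neg zero    (+ suc _) = refl
walks-neg zero    -[1+ _ ]  = refl
walks-neg (suc j) z = begin
  walks j (- z -ℤ + 1) + walks j (- z +ℤ + 1)     ≡⟨ cong₂ _+_ (cong (walks j) (sym (neg-distrib-+ z (+ 1))))
                                                                (cong (walks j) (sym (neg-distrib-+ z (- + 1)))) ⟩
  walks j (- (z +ℤ + 1)) + walks j (- (z -ℤ + 1)) ≡⟨ cong₂ _+_ (walks-neg j (z +ℤ + 1)) (walks-neg j (z -ℤ + 1)) ⟩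
  walks j (z +ℤ + 1) + walks j (z -ℤ + 1)         ≡⟨ +-comm (walks j (z +ℤ + 1)) _ ⟩
  walks j (z -ℤ + 1) + walks j (z +ℤ + 1)         ∎

trinom≡binomial-walks : ∀ m z → trinom m z ≡ ∑ (suc m) (λ j → (m C j) * walks j z)
trinom≡binomial-walks zero    (+ zero)  = refl
trinom≡binomial-walks zero    (+ suc _) = refl
trinom≡binomial-walks zero    -[1+ _ ]  = refl
trinom≡binomial-walks (suc m) z = begin
  trinom m (z -ℤ + 1) + trinom m z + trinom m (z +ℤ + 1)
    ≡⟨ cong₂ _+_ (cong₂ _+_ (trinom≡binomial-walks m (z -ℤ + 1)) (trinom≡binomial-walks m z))
                 (trinom≡binomial-walks m (z +ℤ + 1)) ⟩
  W (z -ℤ + 1) + W z + W (z +ℤ + 1)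
    ≡⟨ xy∙z≈y∙xz (W (z -ℤ + 1)) (W z) (W (z +ℤ + 1)) ⟩
  W z + (W (z -ℤ + 1) + W (z +ℤ + 1))
    ≡⟨ cong (_+_ (W z)) (sym (∑-distrib-+ (suc m) (λ j → (m C j) * walks j (z -ℤ + 1)) (λ j → (m C j) * walks j (z +ℤ + 1)))) ⟩
  W z + ∑ (suc m) (λ j → (m C j) * walks j (z -ℤ + 1) + (m C j) * walks j (z +ℤ + 1))
    ≡⟨ cong (_+_ (W z)) (∑-cong (suc m) (λ j → sym (*-distribˡ-+ (m C j) (walks j (z -ℤ + 1)) (walks j (z +ℤ + 1))))) ⟩
  W z + ∑ (suc m) (λ j → (m C j) * walks (suc j) z)
    ≡⟨ sym (binomial-step m (λ j → walks j z)) ⟩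
  ∑ (suc (suc m)) (λ j → (suc m C j) * walks j z)
    ∎
  where
  W : ℤ → ℕ
  W y = ∑ (suc m) (λ j → (m C j) * walks j y)

C-middle : ∀ {j} m → j ≡ m + suc m → j C m ≡ j C suc m
C-middle m refl = trans (nCk≡nC[n∸k] (m≤m+n m (suc m))) (cong (_C_ (m + suc m)) (m+n∸m≡n m (suc m)))

walks-even : ∀ j d m → j + d ≡ m * 2 → walks j (+ d) ≡ j C m
walks-even zero    zero    zero    _  = refl
walks-even zero    (suc d) (suc m) _  = refl
walks-even (suc j) zero    (suc m) eq = begin
  walks j (- + 1) + walks j (+ 1) ≡⟨ cong (_+ walks j (+ 1)) (walks-neg j (+ 1)) ⟩
  walks j (+ 1) + walks j (+ 1)   ≡⟨ cong₂ _+_ (trans walks-one (sym (C-middle m (trans j≡odd ([1+m*2]≡m+[1+m] m))))) walks-one ⟩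
  j C m + j C suc m               ≡⟨ nCk+nC[k+1]≡[n+1]C[k+1] j m ⟩
  suc j C suc m                   ∎
  where
  [1+m*2]≡m+[1+m] : ∀ m → suc (m * 2) ≡ m + suc m
  [1+m*2]≡m+[1+m] = solve-∀
  j≡odd : j ≡ suc (m * 2)
  j≡odd = trans (sym (+-identityʳ j)) (suc-injective eq)
  walks-one : walks j (+ 1) ≡ j C suc m
  walks-one = walks-even j 1 (suc m) (trans (+-comm j 1) (cong suc j≡odd))
walks-even (suc j) (suc d) (suc m) eq = begin
  walks j (+ d) + walks j (+ (suc d + 1)) ≡⟨ cong₂ _+_ (walks-even j d m (suc-injective (trans (sym (+-suc j d)) j+1+d≡))) walks-up ⟩
  j C m + j C suc m                       ≡⟨ nCk+nC[k+1]≡[n+1]C[k+1] j m ⟩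
  suc j C suc m                           ∎
  where
  j+1+d≡ : j + suc d ≡ suc (m * 2)
  j+1+d≡ = suc-injective eq
  walks-up : walks j (+ (suc d + 1)) ≡ j C suc m
  walks-up = trans (cong (λ e → walks j (+ e)) (+-comm (suc d) 1))
                   (walks-even j (suc (suc d)) (suc m) (trans (+-suc j (suc d)) (cong suc j+1+d≡)))

walks-odd : ∀ j d m → j + d ≡ suc (m * 2) → walks j (+ d) ≡ 0
walks-odd zero    (suc d) m _ = refl
walks-odd (suc j) zero    m eq = cong₂ _+_ (trans (walks-neg j (+ 1)) walks-one) walks-one
  where
  walks-one : walks j (+ 1) ≡ 0
  walks-one = walks-odd j 1 m (trans (+-comm j 1) (cong suc (trans (sym (+-identityʳ j)) (suc-injective eq))))
walks-odd (suc j) (suc d) zero eq with trans (sym (+-suc j d)) (suc-injective eq)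
... | ()
walks-odd (suc j) (suc d) (suc m) eq =
  cong₂ _+_ (walks-odd j d m (suc-injective (trans (sym (+-suc j d)) j+1+d≡)))
            (trans (cong (λ e → walks j (+ e)) (+-comm (suc d) 1))
                   (walks-odd j (suc (suc d)) (suc m) (trans (+-suc j (suc d)) (cong suc j+1+d≡))))
  where
  j+1+d≡ : j + suc d ≡ suc (suc (m * 2))
  j+1+d≡ = suc-injective eq

even-or-odd : ∀ x → ∃[ m ] (x ≡ m * 2 ⊎ x ≡ suc (m * 2))
even-or-odd zero = 0 , inj₁ refl
even-or-odd (suc x) with even-or-odd x
... | m , inj₁ x≡even = m , inj₂ (cong suc x≡even)
... | m , inj₂ x≡odd  = suc m , inj₁ (cong suc x≡odd)

-- The right-hand summand at k = j + 1, where k ∸ 1 and k + d ∸ 1 reduce to j and j + d.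
walks-summand : ∀ c j d →
  c * walks j (+ d) ≡ (if suc (j + d) % 2 ≡ᵇ 1 then c * (j C ((j + d) / 2)) else 0)
walks-summand c j d = by-parity (even-or-odd (j + d))
  where
  select : ℕ → ℕ
  select r = if r ≡ᵇ 1 then c * (j C ((j + d) / 2)) else 0
  parity : ℕ
  parity = suc (j + d) % 2
  by-parity : ∃[ m ] (j + d ≡ m * 2 ⊎ j + d ≡ suc (m * 2)) → c * walks j (+ d) ≡ select parity
  by-parity (m , inj₁ e) = begin
    c * walks j (+ d)        ≡⟨ cong (_*_ c) (walks-even j d m e) ⟩
    c * (j C m)              ≡⟨ cong (λ h → c * (j C h)) (sym (trans (cong (_/ 2) e) (m*n/n≡m m 2))) ⟩
    c * (j C ((j + d) / 2))  ≡⟨ cong select (sym (trans (cong (λ x → suc x % 2) e) ([m+kn]%n≡m%n 1 m 2))) ⟩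
    select parity            ∎
  by-parity (m , inj₂ e) = begin
    c * walks j (+ d)        ≡⟨ cong (_*_ c) (walks-odd j d m e) ⟩
    c * 0                    ≡⟨ *-zeroʳ c ⟩
    0                        ≡⟨ cong select (sym (trans (cong (λ x → suc x % 2) e) (m*n%n≡0 (suc m) 2))) ⟩
    select parity            ∎

lemma2p1 : (n d : ℕ) → d < n →
    sumFrom 0 n (λ k → trinom k (+ d))
      ≡ sumFrom 1 n (λ k → if (k + d) % 2 ≡ᵇ 1
                             then (n C k) * ((k ∸ 1) C ((k + d ∸ 1) / 2))
                             else 0)
lemma2p1 n d _ = begin
  sumFrom 0 n (λ k → trinom k (+ d))                      ≡⟨ sumFrom≡∑ 0 n _ ⟩
  ∑ n (λ k → trinom k (+ d))                              ≡⟨ ∑-cong n (λ k → trinom≡binomial-walks k (+ d)) ⟩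
  ∑ n (λ k → ∑ (suc k) (λ j → (k C j) * walks j (+ d)))   ≡⟨ hockey-stick n (λ j → walks j (+ d)) ⟩
  ∑ n (λ j → (n C suc j) * walks j (+ d))                 ≡⟨ ∑-cong n (λ j → walks-summand (n C suc j) j d) ⟩
  ∑ n (λ j → summand (suc j))                             ≡⟨ sym (sumFrom≡∑ 1 n summand) ⟩
  sumFrom 1 n summand                                     ∎
  where
  summand : ℕ → ℕ
  summand k = if (k + d) % 2 ≡ᵇ 1 then (n C k) * ((k ∸ 1) C ((k + d ∸ 1) / 2)) else 0
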